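{- Let $\mathcal{S}=(X,\Sigma,\to,\leq,x_0)$ be a branch-monotone OLTS and let $x,x'\in X$, $\sigma\in\Sigma^*$ with $x\xrightarrow{\sigma}x'$ and $x\leq x'$. Then for every $n\geq1$ there exists $y_n\in X$ such that $x\xrightarrow{\sigma^n}y_n$ and $x\leq y_n$.
   Context: An OLTS is a tuple $(X,\Sigma,\to,\leq,x_0)$ with state set $X$, finite alphabet $\Sigma$, transition relation ${\to}\subseteq X\times\Sigma\times X$, quasi-ordering $\leq$ on $X$ and initial state $x_0$; $x\xrightarrow{\sigma}x'$ for words $\sigma\in\Sigma^*$ is defined as usual. It is branch-monotone if for all $x,x'\in X$ and $\sigma\in\Sigma^*$ with $x\xrightarrow{\sigma}x'$ and $x\leq x'$, there exists $y$ with $x'\xrightarrow{\sigma}y$ and $x'\leq y$. -}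

module Defs where

open import Level using (Level; _⊔_; suc)
open import Data.Nat using (ℕ; zero; suc)
open import Data.Fin using (Fin)
open import Data.List using (List; []; _∷_; _++_)
open import Data.Product using (Σ; ∃; _×_; _,_)
open import Relation.Binary.PropositionalEquality using (_≡_)
open import Relation.Binary.Structures using (IsPreorder)

record OLTS (a r ℓ : Level) : Set (Level.suc (a ⊔ r ⊔ ℓ)) where
  field
    X     : Set a
    k     : ℕ
    _—[_]→_ : X → Fin k → X → Set r
    _≤_   : X → X → Set ℓ
    ≤-isQuasiOrder : IsPreorder _≡_ _≤_
    x₀    : X

  Letter : Set
  Letter = Fin k

  Word : Set
  Word = List Letter

  data _—[_]→*_ : X → Word → X → Set (a ⊔ r) where
    ε-step : ∀ {x} → x —[ [] ]→* x
    ∷-step : ∀ {x y z a w} → x —[ a ]→ y → y —[ w ]→* z → x —[ a ∷ w ]→* z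

open OLTS public

_^w_ : ∀ {A : Set} → List A → ℕ → List A
σ ^w zero  = []
σ ^w suc n = σ ++ (σ ^w n)

BranchMonotone : ∀ {a r ℓ} → OLTS a r ℓ → Set (a ⊔ r ⊔ ℓ)
BranchMonotone S =
  ∀ (x x' : X S) (σ : Word S) →
  _—[_]→*_ S x σ x' → _≤_ S x x' →
  Σ (X S) λ y → _—[_]→*_ S x' σ y × _≤_ S x' y

{-# OPTIONS --safe #-}
module Submission where

open import Defs using (OLTS; X; Word; _—[_]→*_; _≤_; ≤-isQuasiOrder; ε-step; ∷-step; _^w_; BranchMonotone)
open import Data.Nat using (ℕ; _≥_; zero; suc)
open import Data.Product using (Σ; _×_; _,_)
open import Data.List using (_∷_; _++_)
open import Relation.Binary.Structures using (IsPreorder)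

-- Branch-monotonicity turns a run x —σ→ x' with x ≤ x' into a run x' —σ→ y₁
-- with x' ≤ y₁ of the same shape, so by induction on n (generalising over the
-- starting pair) the runs chain into x —σⁿ→ y, and transitivity gives x ≤ y.

module _ {a r ℓ} (S : OLTS a r ℓ) where
  open OLTS S using () renaming (_—[_]→*_ to _⇒[_]_; _≤_ to _≼_)
  open IsPreorder (≤-isQuasiOrder S) using (refl; trans)

  ⇒-++ : ∀ {x y z} (u v : Word S) → x ⇒[ u ] y → y ⇒[ v ] z → x ⇒[ u ++ v ] z
  ⇒-++ _       _ ε-step       q = q
  ⇒-++ (_ ∷ u) v (∷-step t p) q = ∷-step t (⇒-++ u v p q)

  branchMonotone⇒pumping : BranchMonotone S →
    ∀ {x x'} (σ : Word S) → x ⇒[ σ ] x' → x ≼ x' →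
    (n : ℕ) → Σ (X S) λ y → x ⇒[ σ ^w n ] y × x ≼ y
  branchMonotone⇒pumping bm {x} σ p x≼x' zero = x , ε-step , refl
  branchMonotone⇒pumping bm {x} {x'} σ p x≼x' (suc n)
    with bm x x' σ p x≼x'
  ... | y₁ , q , x'≼y₁
    with branchMonotone⇒pumping bm σ q x'≼y₁ n
  ... | y , q' , x'≼y = y , ⇒-++ σ (σ ^w n) p q' , trans x≼x' x'≼y

proposition3p6 : ∀ {a r ℓ} (S : OLTS a r ℓ) → BranchMonotone S →
    (x x' : X S) (σ : Word S) → _—[_]→*_ S x σ x' → _≤_ S x x' →
    (n : ℕ) → n ≥ 1 →
    Σ (X S) λ y → _—[_]→*_ S x (σ ^w n) y × _≤_ S x y
proposition3p6 S bm _ _ σ p x≤x' n _ = branchMonotone⇒pumping S bm σ p x≤x' n
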